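{- Let $G_r=(V_r,E_r)$ (virtual network) and $G_s=(V_s,E_s)$ (substrate network) be simple, connected, undirected graphs, with integer demands $d$ on $V_r\cup E_r$ and integer capacities $c$ on $V_s\cup E_s$. Let $l\in V_s$ be a leaf of $G_s$ (a node with exactly one neighbor) and let $v_l$ be its unique neighbor. Let $m$ be any feasible mapping of $G_r$ on $G_s$ with incidence vector $(x,y)=\chi(m)$. Then for every virtual edge $\bar e=(\bar u,\bar v)\in E_r$, the leaf equality $$y_{\bar e (l,v_l)}=x_{\bar u l}$$ holds. Consequently this equality is valid for the VNE polytope $\mathrm{conv}\{\chi(m): m \text{ feasible mapping}\}$.
   Context: A mapping $m=(m_V,m_E)$ of $G_r$ on $G_s$ consists of an injective (one-to-one) node placement $m_V:V_r\to V_s$ and an edge routing $m_E$ assigning to each $\bar e=(\bar u,\bar v)\in E_r$ a loop-free path $m_E(\bar e)$ of $G_s$ with endpoints $m_V(\bar u)$ and $m_V(\bar v)$. It is feasible if for each $u\in V_s$ the sum of $d_{\bar u}$ over virtual nodes placed on $u$ is at most $c_u$, and for each $e\in E_s$ the sum of $d_{\bar e}$ over virtual edges whose path uses $e$ is at most $c_e$. Each virtual edge is given a fixed orientation $\bar e=(\bar u,\bar v)$. Let $E'_s=\bigcup_{\{u,v\}\in E_s}\{(u,v),(v,u)\}$ be the arc set of the bidirected substrate network. The incidence vector $\chi(m)=(x,y)$ has components $x_{\bar u u}\in\{0,1\}$ for $\bar u\in V_r,u\in V_s$, with $x_{\bar u u}=1$ iff $m_V(\bar u)=u$, and $y_{\bar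 e a}\in\{0,1\}$ for $\bar e\in E_r$, $a\in E'_s$, with $y_{\bar e (u,v)}=1$ iff the path $m_E(\bar e)$, traversed from $m_V(\bar u)$ to $m_V(\bar v)$, uses the substrate edge $\{u,v\}$ in the direction from $u$ to $v$. -}

module Defs where

open import Data.Nat using (ℕ)
open import Data.Integer using (ℤ; _+_; _≤_; 0ℤ)
open import Data.Fin using (Fin; zero; suc; _≟_)
open import Data.List using (List; []; _∷_; length; lookup; head; last)
open import Data.List.Relation.Unary.All using (All)
open import Data.List.Relation.Unary.Unique.Propositional using (Unique)
open import Data.List.Membership.Propositional using (_∈_)
open import Data.Product using (Σ; _×_; _,_; proj₁; proj₂)
open import Data.Sum using (_⊎_)
open import Data.Maybe using (Maybe; just)
open import Data.Bool using (Bool; true; false; if_then_else_; _∨_; _∧_)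
open import Relation.Nullary using (¬_; ⌊_⌋)
open import Relation.Binary.PropositionalEquality using (_≡_; _≢_)
open import Function.Definitions using (Injective)

SameEdge : {n : ℕ} → Fin n × Fin n → Fin n × Fin n → Set
SameEdge (u , v) (u' , v') = (u ≡ u' × v ≡ v') ⊎ (u ≡ v' × v ≡ u')

-- A simple undirected graph on vertex set Fin n. Each edge is listed exactly
-- once, with a fixed (arbitrary) orientation (u , v).
record Graph : Set where
  field
    n      : ℕ
    edges  : List (Fin n × Fin n)
    noLoop : All (λ e → proj₁ e ≢ proj₂ e) edges
    noPar  : (i j : Fin (length edges)) → i ≢ j →
             ¬ SameEdge (lookup edges i) (lookup edges j)

open Graph public

E : Graph → Set
E G = Fin (length (edges G))

src : (G : Graph) → E G → Fin (n G)
src G e = proj₁ (lookup (edges G) e)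

tgt : (G : Graph) → E G → Fin (n G)
tgt G e = proj₂ (lookup (edges G) e)

Adj : (G : Graph) → Fin (n G) → Fin (n G) → Set
Adj G u v = ((u , v) ∈ edges G) ⊎ ((v , u) ∈ edges G)

steps : {A : Set} → List A → List (A × A)
steps []           = []
steps (x ∷ [])     = []
steps (x ∷ y ∷ xs) = (x , y) ∷ steps (y ∷ xs)

record Path (G : Graph) (a b : Fin (n G)) : Set where
  field
    verts    : List (Fin (n G))
    starts   : head verts ≡ just a
    ends     : last verts ≡ just b
    adjacent : All (λ s → Adj G (proj₁ s) (proj₂ s)) (steps verts)
    loopFree : Unique verts

open Path public

Connected : Graph → Set
Connected G = (u v : Fin (n G)) → Path G u v

IsLeafWithNeighbour : (G : Graph) → Fin (n G) → Fin (n G) → Set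
IsLeafWithNeighbour G l vl = Adj G l vl × ((w : Fin (n G)) → Adj G l w → w ≡ vl)

record Mapping (Gr Gs : Graph) : Set where
  field
    mV    : Fin (n Gr) → Fin (n Gs)
    mV-inj : Injective _≡_ _≡_ mV
    mE    : (e : E Gr) → Path Gs (mV (src Gr e)) (mV (tgt Gr e))

open Mapping public

usesArc : {k : ℕ} → List (Fin k) → Fin k → Fin k → Bool
usesArc []           u v = false
usesArc (x ∷ [])     u v = false
usesArc (x ∷ y ∷ xs) u v = (⌊ x ≟ u ⌋ ∧ ⌊ y ≟ v ⌋) ∨ usesArc (y ∷ xs) u v

xvar : {Gr Gs : Graph} → Mapping Gr Gs → Fin (n Gr) → Fin (n Gs) → ℕ
xvar m ū u = if ⌊ mV m ū ≟ u ⌋ then 1 else 0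

yvar : {Gr Gs : Graph} → Mapping Gr Gs → E Gr → Fin (n Gs) → Fin (n Gs) → ℕ
yvar m ē u v = if usesArc (verts (mE m ē)) u v then 1 else 0

sumFin : (k : ℕ) → (Fin k → ℤ) → ℤ
sumFin ℕ.zero    f = 0ℤ
sumFin (ℕ.suc k) f = f zero + sumFin k (λ i → f (suc i))

Feasible : (Gr Gs : Graph) →
           (dV : Fin (n Gr) → ℤ) (dE : E Gr → ℤ) →
           (cV : Fin (n Gs) → ℤ) (cE : E Gs → ℤ) →
           Mapping Gr Gs → Set
Feasible Gr Gs dV dE cV cE m =
  ((u : Fin (n Gs)) →
     sumFin (n Gr) (λ ū → if ⌊ mV m ū ≟ u ⌋ then dV ū else 0ℤ) ≤ cV u)
  × ((e : E Gs) →
     sumFin (length (edges Gr)) (λ ē →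
       if usesArc (verts (mE m ē)) (src Gs e) (tgt Gs e)
          ∨ usesArc (verts (mE m ē)) (tgt Gs e) (src Gs e)
       then dE ē else 0ℤ) ≤ cE e)

{-# OPTIONS --safe #-}
module Submission where

-- A leaf l is entered and left only through its neighbour vl. A loop-free path
-- starting at l must leave it at its first step, hence through the arc (l , vl).
-- A loop-free path starting elsewhere can only enter l from vl and afterwards
-- cannot visit vl again, so it never traverses (l , vl).

open import Defs
open import Data.Nat using (ℕ)
open import Data.Integer using (ℤ)
open import Data.Fin using (Fin; _≟_)
open import Data.List using (List; []; _∷_; last)
open import Data.List.Relation.Unary.All as All using (All; []; _∷_)
open import Data.List.Relation.Unary.AllPairs using (_∷_)
open import Data.List.Relation.Unary.Unique.Propositional using (Unique)
open import Data.List.Membership.Propositional.Properties using (∈-lookup)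
open import Data.Maybe using (just)
open import Data.Product using (_,_; proj₁; proj₂)
open import Data.Sum using (swap)
open import Data.Bool using (true; false; _∨_; if_then_else_)
open import Data.Bool.Properties using (∧-zeroʳ)
open import Relation.Nullary using (yes; no; contradiction; ⌊_⌋)
open import Relation.Binary.PropositionalEquality
  using (_≡_; _≢_; refl; sym; trans; cong; ≢-sym)

IsWalk : (G : Graph) → List (Fin (n G)) → Set
IsWalk G xs = All (λ s → Adj G (proj₁ s) (proj₂ s)) (steps xs)

module _ {k : ℕ} {u v : Fin k} where

  usesArc-head : ∀ xs → usesArc (u ∷ v ∷ xs) u v ≡ true
  usesArc-head xs with u ≟ u | v ≟ v
  ... | yes _   | yes _   = refl
  ... | no u≢u  | _       = contradiction refl u≢u
  ... | yes _   | no v≢v  = contradiction refl v≢v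

  usesArc-tail-≢src : ∀ {x y} xs → x ≢ u → usesArc (x ∷ y ∷ xs) u v ≡ usesArc (y ∷ xs) u v
  usesArc-tail-≢src {x} xs x≢u with x ≟ u
  ... | yes x≡u = contradiction x≡u x≢u
  ... | no _    = refl

  usesArc-tail-≢tgt : ∀ {x y} xs → y ≢ v → usesArc (x ∷ y ∷ xs) u v ≡ usesArc (y ∷ xs) u v
  usesArc-tail-≢tgt {x} {y} xs y≢v with y ≟ v
  ... | yes y≡v = contradiction y≡v y≢v
  ... | no _    = cong (_∨ usesArc (y ∷ xs) u v) (∧-zeroʳ ⌊ x ≟ u ⌋)

src≢tgt : (G : Graph) (e : E G) → src G e ≢ tgt G e
src≢tgt G e = All.lookup (noLoop G) (∈-lookup e)

mapped-src≢tgt : ∀ {Gr Gs} (m : Mapping Gr Gs) (ē : E Gr) →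
                 mV m (src Gr ē) ≢ mV m (tgt Gr ē)
mapped-src≢tgt {Gr} m ē eq = src≢tgt Gr ē (mV-inj m eq)

module _ {G : Graph} {l vl : Fin (n G)} (leaf : IsLeafWithNeighbour G l vl) where

  neighbour-of-leaf : ∀ {w} → Adj G l w → w ≡ vl
  neighbour-of-leaf = proj₂ leaf _

  walk-from-leaf-usesArc : ∀ {b} xs → b ≢ l → last (l ∷ xs) ≡ just b →
                           IsWalk G (l ∷ xs) → usesArc (l ∷ xs) l vl ≡ true
  walk-from-leaf-usesArc []       b≢l refl _ = contradiction refl b≢l
  walk-from-leaf-usesArc (y ∷ ys) _   _    (l~y ∷ _) with neighbour-of-leaf l~y
  ... | refl = usesArc-head ys

  mutual
    walk-avoids-leafArc : ∀ {x} xs → x ≢ l → IsWalk G (x ∷ xs) → Unique (x ∷ xs) →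
                          usesArc (x ∷ xs) l vl ≡ false
    walk-avoids-leafArc [] _ _ _ = refl
    walk-avoids-leafArc {x} (y ∷ ys) x≢l (x~y ∷ walk) (x∉ ∷ unique) with y ≟ l
    ... | no y≢l = trans (usesArc-tail-≢src ys x≢l) (walk-avoids-leafArc ys y≢l walk unique)
    ... | yes refl = trans (usesArc-tail-≢src ys x≢l)
                           (walk-leaving-leaf-avoids-leafArc ys vl∉ys walk unique)
      where
      x≡vl : x ≡ vl
      x≡vl = neighbour-of-leaf (swap x~y)

      vl∉ys : All (_≢ vl) ys
      vl∉ys = All.map (λ x≢z z≡vl → x≢z (trans x≡vl (sym z≡vl))) (All.tail x∉)

    walk-leaving-leaf-avoids-leafArc : ∀ ys → All (_≢ vl) ys → IsWalk G (l ∷ ys) →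
                                       Unique (l ∷ ys) → usesArc (l ∷ ys) l vl ≡ false
    walk-leaving-leaf-avoids-leafArc []       _            _          _ = refl
    walk-leaving-leaf-avoids-leafArc (z ∷ zs) (z≢vl ∷ _) (_ ∷ walk) ((l≢z ∷ _) ∷ unique) =
      trans (usesArc-tail-≢tgt zs z≢vl) (walk-avoids-leafArc zs (≢-sym l≢z) walk unique)

  path-usesArc-leaf : ∀ {a b} → a ≢ b → (p : Path G a b) →
                      usesArc (verts p) l vl ≡ ⌊ a ≟ l ⌋
  path-usesArc-leaf {a} a≢b p
    with verts p | starts p | ends p | adjacent p | loopFree p
  ... | .a ∷ xs | refl | ends | walk | unique with a ≟ l
  ...   | yes refl = walk-from-leaf-usesArc xs (≢-sym a≢b) ends walk
  ...   | no a≢l   = walk-avoids-leafArc xs a≢l walk unique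

proposition3 : (Gr Gs : Graph) → Connected Gr → Connected Gs →
               (dV : Fin (n Gr) → ℤ) (dE : E Gr → ℤ) →
               (cV : Fin (n Gs) → ℤ) (cE : E Gs → ℤ) →
               (l vl : Fin (n Gs)) → IsLeafWithNeighbour Gs l vl →
               (m : Mapping Gr Gs) → Feasible Gr Gs dV dE cV cE m →
               (ē : E Gr) → yvar m ē l vl ≡ xvar m (src Gr ē) l
proposition3 Gr Gs _ _ _ _ _ _ l vl leaf m _ ē =
  cong (λ b → if b then 1 else 0)
       (path-usesArc-leaf leaf (mapped-src≢tgt m ē) (mE m ē))
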